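{- Let $G$ be a group and $\pi=\{C_1,\dots,C_k\}$ a collection of $k$ distinct subsets of $G$, each of size $k$ and containing $e$, pairwise intersecting exactly in $\{e\}$ and satisfying the $T$-axiom, such that $X=\mathrm{BCay}(G,\pi)$ is $\beta$-regular. Write $C_1=\{g_1,g_2,\dots,g_k\}$ with $g_1=e$, and suppose the cells are labelled so that $C_i=g_i^{ -1}C_1$ for each $i$. Let $\pi^*=\{C_1^{ -1},g_2C_1^{ -1},\dots,g_kC_1^{ -1}\}$. Then $\pi^*$ consists of $k$ subsets of $G$ of size $k$ containing $e$, pairwise intersecting exactly in $\{e\}$ and satisfying the $T$-axiom (so $\mathrm{BCay}(G,\pi^*)$ is a well-defined Cayley incidence graph), and $\mathrm{BCay}(G,\pi^*)$ is isomorphic to $X$.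
   Context: For $C\subseteq G$ and $g\in G$, $gC=\{gs:s\in C\}$ and $C^{ -1}=\{s^{ -1}:s\in C\}$. A collection $\pi$ of subsets of $G$, each containing $e$, satisfies the $T$-axiom if for every $C\in\pi$ and $s\in C$, $s^{ -1}C\in\pi$. The Cayley incidence graph $\mathrm{BCay}(G,\pi)$ is the bipartite graph with parts $\gamma=G$ and $\beta=\{gC:g\in G,C\in\pi\}$ (a set of subsets), with $g$ adjacent to $gC$ for every $g\in G$, $C\in\pi$. It is $\beta$-regular if the action of $G$ on $\beta$ by left multiplication, $h\cdot(gC)=(hg)C$, is regular. -}

module Defs where

open import Level using (Level; _⊔_; Lift; lift)
open import Algebra.Bundles using (Group)
open import Data.Nat using (ℕ; suc)
open import Data.Fin using (Fin; zero; suc)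
open import Data.Product using (Σ; ∃; ∃-syntax; _×_; _,_)
open import Data.Sum using (_⊎_; inj₁; inj₂)
open import Data.Empty.Polymorphic using (⊥)
open import Relation.Binary.PropositionalEquality using (_≡_)
open import Relation.Nullary using (¬_)

module Cay {c ℓ : Level} (G : Group c ℓ) where
  open Group G

  Subset : Set (Level.suc (c ⊔ ℓ))
  Subset = Carrier → Set (c ⊔ ℓ)

  _⊆_ : Subset → Subset → Set (c ⊔ ℓ)
  A ⊆ B = ∀ x → A x → B x

  _≐_ : Subset → Subset → Set (c ⊔ ℓ)
  A ≐ B = (A ⊆ B) × (B ⊆ A)

  _·_ : Carrier → Subset → Subset
  (g · C) x = ∃[ s ] (C s × x ≈ g ∙ s)

  inv : Subset → Subset
  inv C x = ∃[ s ] (C s × x ≈ s ⁻¹)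

  image : ∀ {k} → (Fin k → Carrier) → Subset
  image f x = Lift c (∃[ i ] (x ≈ f i))

  InjectiveEnum : ∀ {k} → (Fin k → Carrier) → Set ℓ
  InjectiveEnum f = ∀ i j → f i ≈ f j → i ≡ j

  HasSize : ℕ → Subset → Set (c ⊔ ℓ)
  HasSize k C = Σ (Fin k → Carrier) λ f → InjectiveEnum f × (C ≐ image f)

  record IsCellFamily (m k : ℕ) (π : Fin m → Subset) : Set (c ⊔ ℓ) where
    field
      distinct     : ∀ i j → π i ≐ π j → i ≡ j
      size         : ∀ i → HasSize k (π i)
      contains-e   : ∀ i → π i ε
      intersect-e  : ∀ i j → ¬ (i ≡ j) → ∀ x → π i x → π j x → x ≈ ε
      T-axiom      : ∀ i s → π i s → ∃[ j ] (((s ⁻¹) · π i) ≐ π j)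

  -- β-part of BCay(G,π): blocks gC written as pairs (g , i) meaning g·(π i);
  -- two pairs denote the same block iff the subsets are equal.
  module _ {m : ℕ} (π : Fin m → Subset) where
    Block : Set c
    Block = Carrier × Fin m

    toSubset : Block → Subset
    toSubset (g , i) = g · π i

    _≈β_ : Block → Block → Set (c ⊔ ℓ)
    b ≈β b' = toSubset b ≐ toSubset b'

    act : Carrier → Block → Block
    act h (g , i) = (h ∙ g , i)

    BetaRegular : Set (c ⊔ ℓ)
    BetaRegular = ∀ b b' → ∃[ h ] ((act h b ≈β b') × (∀ h' → act h' b ≈β b' → h' ≈ h))

    Vertex : Set c
    Vertex = Carrier ⊎ Block

    _≈V_ : Vertex → Vertex → Set (c ⊔ ℓ)
    inj₁ g ≈V inj₁ h = Lift c (g ≈ h)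
    inj₂ b ≈V inj₂ b' = b ≈β b'
    _ ≈V _ = ⊥

    Incident : Carrier → Block → Set (c ⊔ ℓ)
    Incident g b = ∃[ i ] ((g · π i) ≐ toSubset b)

    Adj : Vertex → Vertex → Set (c ⊔ ℓ)
    Adj (inj₁ g) (inj₂ b) = Incident g b
    Adj (inj₂ b) (inj₁ g) = Incident g b
    Adj _ _ = ⊥

  record BCayIso {m₁ m₂ : ℕ} (π₁ : Fin m₁ → Subset) (π₂ : Fin m₂ → Subset)
         : Set (c ⊔ ℓ) where
    field
      to        : Vertex π₁ → Vertex π₂
      from      : Vertex π₂ → Vertex π₁
      to-cong   : ∀ u v → _≈V_ π₁ u v → _≈V_ π₂ (to u) (to v)
      from-cong : ∀ u v → _≈V_ π₂ u v → _≈V_ π₁ (from u) (from v)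
      from-to   : ∀ u → _≈V_ π₁ (from (to u)) u
      to-from   : ∀ v → _≈V_ π₂ (to (from v)) v
      adj-to    : ∀ u v → Adj π₁ u v → Adj π₂ (to u) (to v)
      adj-from  : ∀ u v → Adj π₂ u v → Adj π₁ (from u) (from v)

  -- π* = { C₁⁻¹ , g₂C₁⁻¹ , … , g_k C₁⁻¹ }  (k = suc n, C₁ = π zero)
  piStar : ∀ {n} → (Fin (suc n) → Subset) → (Fin (suc n) → Carrier)
           → Fin (suc n) → Subset
  piStar C g zero = inv (C zero)
  piStar C g (suc i) = g (suc i) · inv (C zero)

-- Because Cᵢ = gᵢ⁻¹C₁, every block hCᵢ of BCay(G,π) is a translate rC₁ with
-- r = hgᵢ⁻¹, and every block hπ*ᵢ = hgᵢC₁⁻¹ is a translate rC₁⁻¹ with r = hgᵢ.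
-- In both graphs the representative r is unique: for rC₁ by β-regularity, for
-- rC₁⁻¹ because distinct cells meet only in e. So blocks of either graph are
-- group elements, and a vertex h lies on rC₁⁻¹ iff r ∈ hC₁. Hence h ↦ hC₁ and
-- rC₁⁻¹ ↦ r is an isomorphism BCay(G,π*) ≅ BCay(G,π). The cell axioms for π*
-- are read off from the description π*ᵢ = {gᵢg⁻¹ₐ}.
module Submission where

open import Defs
open import Level using (Level; lift)
open import Algebra.Bundles using (Group)
open import Data.Nat using (ℕ; suc)
open import Data.Fin using (Fin; zero)
open import Data.Fin.Properties using (_≟_)
open import Data.Product using (_×_; _,_; ∃-syntax; proj₁; proj₂)
open import Data.Sum using (inj₁; inj₂)
open import Data.Empty using (⊥-elim)
open import Relation.Binary.PropositionalEquality using (_≡_; _≢_)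
import Relation.Binary.PropositionalEquality as ≡
open import Relation.Nullary using (yes; no)
import Algebra.Properties.Group as GroupProperties
import Relation.Binary.Reasoning.Setoid as SetoidReasoning

module GroupAlgebra {c ℓ : Level} (G : Group c ℓ) where
  open Group G
  open GroupProperties G
  open SetoidReasoning setoid

  x⁻¹∙y≈ε⇒x≈y : ∀ x y → x ⁻¹ ∙ y ≈ ε → x ≈ y
  x⁻¹∙y≈ε⇒x≈y x y e = ⁻¹-injective (inverseˡ-unique (x ⁻¹) y e)

  x≈y∙z⁻¹⇒x⁻¹∙y≈z : ∀ {x y z} → x ≈ y ∙ z ⁻¹ → x ⁻¹ ∙ y ≈ z
  x≈y∙z⁻¹⇒x⁻¹∙y≈z {x} {y} {z} e =
    sym (y≈x\\z x z y (trans (∙-congʳ e) (//-rightDividesˡ z y)))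

  x∙y⁻¹≈z∙w⁻¹⇒z⁻¹∙x≈w⁻¹∙y : ∀ {x y z w} → x ∙ y ⁻¹ ≈ z ∙ w ⁻¹ → z ⁻¹ ∙ x ≈ w ⁻¹ ∙ y
  x∙y⁻¹≈z∙w⁻¹⇒z⁻¹∙x≈w⁻¹∙y {x} {y} {z} {w} e = begin
    z ⁻¹ ∙ x                ≈⟨ ∙-congˡ (//-rightDividesˡ y x) ⟨
    z ⁻¹ ∙ (x ∙ y ⁻¹ ∙ y)   ≈⟨ ∙-congˡ (∙-congʳ e) ⟩
    z ⁻¹ ∙ (z ∙ w ⁻¹ ∙ y)   ≈⟨ ∙-congˡ (assoc z (w ⁻¹) y) ⟩
    z ⁻¹ ∙ (z ∙ (w ⁻¹ ∙ y)) ≈⟨ \\-leftDividesʳ z (w ⁻¹ ∙ y) ⟩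
    w ⁻¹ ∙ y                ∎

module SubsetProperties {c ℓ : Level} (G : Group c ℓ) where
  open Group G
  open Cay G

  ≐-refl : ∀ {A} → A ≐ A
  ≐-refl = (λ _ a → a) , (λ _ a → a)

  ≐-sym : ∀ {A B} → A ≐ B → B ≐ A
  ≐-sym (A⊆B , B⊆A) = B⊆A , A⊆B

  ≐-trans : ∀ {A B D} → A ≐ B → B ≐ D → A ≐ D
  ≐-trans (A⊆B , B⊆A) (B⊆D , D⊆B) =
    (λ x a → B⊆D x (A⊆B x a)) , (λ x d → B⊆A x (D⊆B x d))

  ·-cong : ∀ {A B} h → A ≐ B → (h · A) ≐ (h · B)
  ·-cong h (A⊆B , B⊆A) =
    (λ { x (s , a , e) → s , A⊆B s a , e }) , (λ { x (s , b , e) → s , B⊆A s b , e })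

  inv-cong : ∀ {A B} → A ≐ B → inv A ≐ inv B
  inv-cong (A⊆B , B⊆A) =
    (λ { x (s , a , e) → s , A⊆B s a , e }) , (λ { x (s , b , e) → s , B⊆A s b , e })

  image-resp : ∀ {k} {f : Fin k → Carrier} {x y} → x ≈ y → image f x → image f y
  image-resp x≈y (lift (a , x≈fa)) = lift (a , trans (sym x≈y) x≈fa)

  image-cong : ∀ {k} {f f′ : Fin k → Carrier} → (∀ a → f a ≈ f′ a) → image f ≐ image f′
  image-cong f≈f′ = (λ { x (lift (a , e)) → lift (a , trans e (f≈f′ a)) })
                  , (λ { x (lift (a , e)) → lift (a , trans e (sym (f≈f′ a))) })

  ·-image : ∀ {k} {f : Fin k → Carrier} h → (h · image f) ≐ image (λ a → h ∙ f a)
  ·-image h = (λ { x (s , lift (a , s≈fa) , x≈hs) → lift (a , trans x≈hs (∙-congˡ s≈fa)) })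
            , (λ { x (lift (a , e)) → _ , lift (a , refl) , e })

  inv-image : ∀ {k} {f : Fin k → Carrier} → inv (image f) ≐ image (λ a → f a ⁻¹)
  inv-image = (λ { x (s , lift (a , s≈fa) , x≈s⁻¹) → lift (a , trans x≈s⁻¹ (⁻¹-cong s≈fa)) })
            , (λ { x (lift (a , e)) → _ , lift (a , refl) , e })

  HasSize-resp-≐ : ∀ {k A B} → A ≐ B → HasSize k A → HasSize k B
  HasSize-resp-≐ A≐B (f , f-injective , A≐image) = f , f-injective , ≐-trans (≐-sym A≐B) A≐image

  IsCellFamily-resp-≐ : ∀ {m k π π′} → (∀ i → π i ≐ π′ i) →
                        IsCellFamily m k π′ → IsCellFamily m k π
  IsCellFamily-resp-≐ {π = π} {π′} π≐π′ family = record
    { distinct    = λ i j e → distinct i j (≐-trans (≐-sym (π≐π′ i)) (≐-trans e (π≐π′ j)))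
    ; size        = λ i → HasSize-resp-≐ (≐-sym (π≐π′ i)) (size i)
    ; contains-e  = λ i → proj₂ (π≐π′ i) ε (contains-e i)
    ; intersect-e = λ i j i≢j x p q → intersect-e i j i≢j x (proj₁ (π≐π′ i) x p) (proj₁ (π≐π′ j) x q)
    ; T-axiom     = T-axiom′
    }
    where
    open IsCellFamily family
    T-axiom′ : ∀ i s → π i s → ∃[ j ] (((s ⁻¹) · π i) ≐ π j)
    T-axiom′ i s s∈πi with T-axiom i s (proj₁ (π≐π′ i) s s∈πi)
    ... | j , e = j , ≐-trans (·-cong (s ⁻¹) (π≐π′ i)) (≐-trans e (≐-sym (π≐π′ j)))

module LabelledCells {c ℓ : Level} (G : Group c ℓ) {n : ℕ}
    (C : Fin (suc n) → Cay.Subset G)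
    (g : Fin (suc n) → Group.Carrier G)
    (g₁≈ε : Group._≈_ G (g zero) (Group.ε G))
    (C₁≐g : Cay._≐_ G (C zero) (Cay.image G g))
    (Cᵢ≐gᵢ⁻¹C₁ : ∀ i → Cay._≐_ G (C i) (Cay._·_ G (Group._⁻¹ G (g i)) (C zero))) where
  open Group G
  open GroupProperties G using (⁻¹-injective; ∙-cancelˡ; ε⁻¹≈ε; x≈z//y; //-rightDividesˡ)
  open GroupAlgebra G
  open Cay G
  open SubsetProperties G

  π* : Fin (suc n) → Subset
  π* = piStar C g

  infix 21 _·C₁ _·C₁⁻¹

  _·C₁ : Carrier → Subset
  r ·C₁ = image (λ a → r ∙ g a)

  _·C₁⁻¹ : Carrier → Subset
  r ·C₁⁻¹ = image (λ a → r ∙ g a ⁻¹)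

  ·C₁-cong : ∀ {r r′} → r ≈ r′ → r ·C₁ ≐ r′ ·C₁
  ·C₁-cong r≈r′ = image-cong (λ a → ∙-congʳ r≈r′)

  ·C₁⁻¹-cong : ∀ {r r′} → r ≈ r′ → r ·C₁⁻¹ ≐ r′ ·C₁⁻¹
  ·C₁⁻¹-cong r≈r′ = image-cong (λ a → ∙-congʳ r≈r′)

  ·-·C₁ : ∀ h r → (h · (r ·C₁)) ≐ (h ∙ r) ·C₁
  ·-·C₁ h r = ≐-trans (·-image h) (image-cong (λ a → sym (assoc h r (g a))))

  ·-·C₁⁻¹ : ∀ h r → (h · (r ·C₁⁻¹)) ≐ (h ∙ r) ·C₁⁻¹
  ·-·C₁⁻¹ h r = ≐-trans (·-image h) (image-cong (λ a → sym (assoc h r (g a ⁻¹))))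

  C-cell : ∀ i → C i ≐ (g i ⁻¹) ·C₁
  C-cell i = ≐-trans (Cᵢ≐gᵢ⁻¹C₁ i) (≐-trans (·-cong (g i ⁻¹) C₁≐g) (·-image (g i ⁻¹)))

  C-member : ∀ {y} j a → y ≈ g j ⁻¹ ∙ g a → C j y
  C-member j a e = proj₂ (C-cell j) _ (lift (a , e))

  π*-cell : ∀ i → π* i ≐ g i ·C₁⁻¹
  π*-cell zero = ≐-trans (inv-cong C₁≐g) (≐-trans inv-image (image-cong x≈g₁∙x))
    where
    x≈g₁∙x : ∀ a → g a ⁻¹ ≈ g zero ∙ g a ⁻¹
    x≈g₁∙x a = sym (trans (∙-congʳ g₁≈ε) (identityˡ (g a ⁻¹)))
  π*-cell i@(Fin.suc _) =
    ≐-trans (·-cong (g i) (≐-trans (inv-cong C₁≐g) inv-image)) (·-image (g i))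

  x∙g₁≈x : ∀ x → x ∙ g zero ≈ x
  x∙g₁≈x x = trans (∙-congˡ g₁≈ε) (identityʳ x)

  x∙g₁⁻¹≈x : ∀ x → x ∙ g zero ⁻¹ ≈ x
  x∙g₁⁻¹≈x x = trans (∙-congˡ (trans (⁻¹-cong g₁≈ε) ε⁻¹≈ε)) (identityʳ x)

  repC : Block C → Carrier
  repC (h , i) = h ∙ g i ⁻¹

  repπ* : Block π* → Carrier
  repπ* (h , i) = h ∙ g i

  C-block : ∀ b → toSubset C b ≐ repC b ·C₁
  C-block (h , i) = ≐-trans (·-cong h (C-cell i)) (·-·C₁ h (g i ⁻¹))

  C₁-block : ∀ h → (h · C zero) ≐ h ·C₁
  C₁-block h = ≐-trans (C-block (h , zero)) (·C₁-cong (x∙g₁⁻¹≈x h))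

  π*-block : ∀ b → toSubset π* b ≐ repπ* b ·C₁⁻¹
  π*-block (h , i) = ≐-trans (·-cong h (π*-cell i)) (·-·C₁⁻¹ h (g i))

  repC-injective : ∀ {b b′} → repC b ≈ repC b′ → _≈β_ C b b′
  repC-injective {b} {b′} e = ≐-trans (C-block b) (≐-trans (·C₁-cong e) (≐-sym (C-block b′)))

  repπ*-injective : ∀ {b b′} → repπ* b ≈ repπ* b′ → _≈β_ π* b b′
  repπ*-injective {b} {b′} e =
    ≐-trans (π*-block b) (≐-trans (·C₁⁻¹-cong e) (≐-sym (π*-block b′)))

  module _ (regular : BetaRegular C) where

    -- β-regularity makes the stabiliser of the block C₁ trivial.
    ·C₁-injective : ∀ {r r′} → r ·C₁ ≐ r′ ·C₁ → r ≈ r′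
    ·C₁-injective {r} {r′} rC₁≐r′C₁ with regular (ε , zero) (r′ , zero)
    ... | _ , _ , unique = trans (unique r (moves rC₁≐r′C₁)) (sym (unique r′ (moves ≐-refl)))
      where
      moves : ∀ {s} → s ·C₁ ≐ r′ ·C₁ → _≈β_ C (act C s (ε , zero)) (r′ , zero)
      moves {s} e = ≐-trans (C₁-block (s ∙ ε))
        (≐-trans (·C₁-cong (identityʳ s)) (≐-trans e (≐-sym (C₁-block r′))))

    repC-cong : ∀ {b b′} → _≈β_ C b b′ → repC b ≈ repC b′
    repC-cong {b} {b′} e = ·C₁-injective (≐-trans (≐-sym (C-block b)) (≐-trans e (C-block b′)))

  module _ (family : IsCellFamily (suc n) (suc n) C) where
    open IsCellFamily family using (intersect-e)

    -- If r g⁻¹ₐ = r′ g⁻¹_b then y = r′⁻¹r equals g⁻¹_b gₐ ∈ C_b. Doing this for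
    -- a = 1 and then for a = b puts y in two cells C_b, C_b′; either b′ = b and
    -- y = g⁻¹_b g_b, or the cells differ and meet only in e.
    ·C₁⁻¹-injective : ∀ {r r′} → r ·C₁⁻¹ ≐ r′ ·C₁⁻¹ → r ≈ r′
    ·C₁⁻¹-injective {r} {r′} (rC₁⁻¹⊆r′C₁⁻¹ , _) = sym (x⁻¹∙y≈ε⇒x≈y r′ r y≈ε)
      where
      y = r′ ⁻¹ ∙ r
      cell-of : ∀ a → ∃[ b ] (C b y × (b ≡ a → y ≈ ε))
      cell-of a with rC₁⁻¹⊆r′C₁⁻¹ (r ∙ g a ⁻¹) (lift (a , refl))
      ... | lift (b , e) = b , C-member b a (x∙y⁻¹≈z∙w⁻¹⇒z⁻¹∙x≈w⁻¹∙y e)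
                         , λ { ≡.refl → trans (x∙y⁻¹≈z∙w⁻¹⇒z⁻¹∙x≈w⁻¹∙y e) (inverseˡ (g a)) }
      y≈ε : y ≈ ε
      y≈ε with cell-of zero
      ... | b , y∈Cb , _ with cell-of b
      ... | b′ , y∈Cb′ , b′≡b⇒y≈ε with b′ ≟ b
      ... | yes b′≡b = b′≡b⇒y≈ε b′≡b
      ... | no b′≢b = intersect-e b′ b b′≢b y y∈Cb′ y∈Cb

    repπ*-cong : ∀ {b b′} → _≈β_ π* b b′ → repπ* b ≈ repπ* b′
    repπ*-cong {b} {b′} e =
      ·C₁⁻¹-injective (≐-trans (≐-sym (π*-block b)) (≐-trans e (π*-block b′)))

    ·C₁⁻¹-isCellFamily : InjectiveEnum g → IsCellFamily (suc n) (suc n) (λ i → g i ·C₁⁻¹)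
    ·C₁⁻¹-isCellFamily g-injective = record
      { distinct    = λ i j e → g-injective i j (·C₁⁻¹-injective e)
      ; size        = λ i → (λ a → g i ∙ g a ⁻¹) , gᵢ∙g⁻¹-injective i , ≐-refl
      ; contains-e  = λ i → image-resp (inverseʳ (g i)) (lift (i , refl))
      ; intersect-e = meet
      ; T-axiom     = λ { i s (lift (a , e)) →
                          a , ≐-trans (·-·C₁⁻¹ (s ⁻¹) (g i)) (·C₁⁻¹-cong (x≈y∙z⁻¹⇒x⁻¹∙y≈z e)) }
      }
      where
      gᵢ∙g⁻¹-injective : ∀ i → InjectiveEnum (λ a → g i ∙ g a ⁻¹)
      gᵢ∙g⁻¹-injective i a b e = g-injective a b (⁻¹-injective (∙-cancelˡ (g i) _ _ e))

      -- For j ≢ b, g⁻¹ⱼ gᵢ = g⁻¹_b gₐ lies in C_j ∩ C_b = {e}, forcing i = j.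
      meet : ∀ i j → i ≢ j → ∀ x → (g i ·C₁⁻¹) x → (g j ·C₁⁻¹) x → x ≈ ε
      meet i j i≢j x (lift (a , x≈gᵢgₐ⁻¹)) (lift (b , x≈gⱼg_b⁻¹)) with j ≟ b
      ... | yes ≡.refl = trans x≈gⱼg_b⁻¹ (inverseʳ (g j))
      ... | no j≢b = ⊥-elim (i≢j (g-injective i j (sym (x⁻¹∙y≈ε⇒x≈y (g j) (g i) gⱼ⁻¹gᵢ≈ε))))
        where
        gⱼ⁻¹gᵢ≈ε : g j ⁻¹ ∙ g i ≈ ε
        gⱼ⁻¹gᵢ≈ε = intersect-e j b j≢b _ (C-member j i refl)
          (C-member b a (x∙y⁻¹≈z∙w⁻¹⇒z⁻¹∙x≈w⁻¹∙y (trans (sym x≈gᵢgₐ⁻¹) x≈gⱼg_b⁻¹)))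

    π*-isCellFamily : InjectiveEnum g → IsCellFamily (suc n) (suc n) π*
    π*-isCellFamily g-injective = IsCellFamily-resp-≐ π*-cell (·C₁⁻¹-isCellFamily g-injective)

  module _ (regular : BetaRegular C) (family : IsCellFamily (suc n) (suc n) C) where

    π*-incident⇒C-incident : ∀ h h′ j → Incident π* h (h′ , j) → Incident C (h′ ∙ g j) (h , zero)
    π*-incident⇒C-incident h h′ j (i , e) = i , repC-injective
      (trans (sym (x≈z//y h (g i) (h′ ∙ g j) (repπ*-cong family e))) (sym (x∙g₁⁻¹≈x h)))

    C-incident⇒π*-incident : ∀ h h′ j → Incident C h (h′ , j) → Incident π* (h′ ∙ g j ⁻¹) (h , zero)
    C-incident⇒π*-incident h h′ j (i , e) = i , repπ*-injective
      (trans (∙-congʳ (sym (repC-cong regular e))) (trans (//-rightDividesˡ (g i) h) (sym (x∙g₁≈x h))))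

    bcayIso : BCayIso π* C
    bcayIso = record
      { to = to ; from = from
      ; to-cong = to-cong ; from-cong = from-cong
      ; from-to = from-to ; to-from = to-from
      ; adj-to = adj-to ; adj-from = adj-from }
      where
      to : Vertex π* → Vertex C
      to (inj₁ h)       = inj₂ (h , zero)
      to (inj₂ (r , j)) = inj₁ (r ∙ g j)

      from : Vertex C → Vertex π*
      from (inj₁ h)       = inj₂ (h , zero)
      from (inj₂ (r , j)) = inj₁ (r ∙ g j ⁻¹)

      to-cong : ∀ u v → _≈V_ π* u v → _≈V_ C (to u) (to v)
      to-cong (inj₁ h) (inj₁ h′) (lift h≈h′) = repC-injective {h , zero} {h′ , zero} (∙-congʳ h≈h′)
      to-cong (inj₂ _) (inj₂ _) b≈b′          = lift (repπ*-cong family b≈b′)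

      from-cong : ∀ u v → _≈V_ C u v → _≈V_ π* (from u) (from v)
      from-cong (inj₁ h) (inj₁ h′) (lift h≈h′) = repπ*-injective {h , zero} {h′ , zero} (∙-congʳ h≈h′)
      from-cong (inj₂ _) (inj₂ _) b≈b′          = lift (repC-cong regular b≈b′)

      from-to : ∀ u → _≈V_ π* (from (to u)) u
      from-to (inj₁ h)       = lift (x∙g₁⁻¹≈x h)
      from-to (inj₂ (r , j)) = repπ*-injective (x∙g₁≈x (r ∙ g j))

      to-from : ∀ v → _≈V_ C (to (from v)) v
      to-from (inj₁ h)       = lift (x∙g₁≈x h)
      to-from (inj₂ (r , j)) = repC-injective (x∙g₁⁻¹≈x (r ∙ g j ⁻¹))

      adj-to : ∀ u v → Adj π* u v → Adj C (to u) (to v)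
      adj-to (inj₁ h) (inj₂ (h′ , j)) = π*-incident⇒C-incident h h′ j
      adj-to (inj₂ (h′ , j)) (inj₁ h) = π*-incident⇒C-incident h h′ j

      adj-from : ∀ u v → Adj C u v → Adj π* (from u) (from v)
      adj-from (inj₁ h) (inj₂ (h′ , j)) = C-incident⇒π*-incident h h′ j
      adj-from (inj₂ (h′ , j)) (inj₁ h) = C-incident⇒π*-incident h h′ j

proposition8p5 : ∀ {c ℓ : Level} (G : Group c ℓ) (n : ℕ)
    (C : Fin (suc n) → Cay.Subset G)
    (g : Fin (suc n) → Group.Carrier G) →
    Cay.IsCellFamily G (suc n) (suc n) C →
    Cay.BetaRegular G C →
    Cay.InjectiveEnum G g →
    Group._≈_ G (g zero) (Group.ε G) →
    Cay._≐_ G (C zero) (Cay.image G g) →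
    (∀ i → Cay._≐_ G (C i) (Cay._·_ G (Group._⁻¹ G (g i)) (C zero))) →
    Cay.IsCellFamily G (suc n) (suc n) (Cay.piStar G C g)
    × Cay.BCayIso G (Cay.piStar G C g) C
proposition8p5 G n C g family regular g-injective g₁≈ε C₁≐g Cᵢ≐gᵢ⁻¹C₁ =
  π*-isCellFamily family g-injective , bcayIso regular family
  where open LabelledCells G C g g₁≈ε C₁≐g Cᵢ≐gᵢ⁻¹C₁
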